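{- Let $m\ge1$, $N$ a positive integer and $B$ an $s\times m$ matrix. If $V_m^B(N)$ is not empty then it contains a unique $\tau$-monotonic composition.
   Context: Let $p$ be a prime, $s\ge1$. For $N=\sum_j n_jp^j$ (base $p$) define $\Gamma(N)=[u_0,\dots,u_{s-1}]^t\in\mathbb{N}^s$ where $u_i=\sum_{j\equiv i \pmod s}n_j$. For an $m$-tuple $X=(X_1,\dots,X_m)$, $\Gamma X$ is the $s\times m$ matrix with columns $\Gamma(X_1),\dots,\Gamma(X_m)$. $\sigma(N)$ is the nondecreasing sequence of powers of $p$ in which $p^j$ appears $n_j$ times; $\tau_h(N)$ ($0\le h\le s-1$) is its subsequence of terms $p^k$ with $k\equiv h\pmod s$. $V_m(N)$ is the set of $m$-tuples of positive integers summing to $N$ with no carryover of $p$-adic digits in the sum and with $(p^s-1)\mid X_j$ for $j\le m-1$; $V_m^B(N)=\{X\in V_m(N):\Gamma X=B\}$. $X\in V_m(N)$ is $\tau$-monotonic if for all $1\le i<j\le m$ and all $h$, every term of $\tau_h(X_i)$ is at most every term of $\tau_h(X_j)$. -}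

module Defs where

open import Data.Nat using (ℕ; zero; suc; _+_; _*_; _∸_; _^_; _≤_; _<_; NonZero)
open import Data.Nat.Properties using (m^n≢0)
open import Data.Nat.DivMod using (_/_; _%_)
open import Data.Nat.Divisibility using (_∣_)
open import Data.Fin using (Fin; toℕ; _<_)
open import Data.Product using (Σ; _×_; ∃)
open import Relation.Binary.PropositionalEquality using (_≡_; _≢_)
open import Relation.Nullary using (yes; no)
open import Data.Nat using (_≟_)

-- j-th base-p digit n_j of N (p = 0 is irrelevant: p is prime in the statement)
digit : (p j N : ℕ) → ℕ
digit zero    j N = 0
digit (suc q) j N = (N / (suc q ^ j)) {{m^n≢0 (suc q) j}} % suc q

sumF : ∀ {m} → (Fin m → ℕ) → ℕ
sumF {zero}  X = 0
sumF {suc m} X = X Fin.zero + sumF (λ k → X (Fin.suc k))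


sumTo : ℕ → (ℕ → ℕ) → ℕ
sumTo zero    f = 0
sumTo (suc n) f = sumTo n f + f n

ind : ℕ → ℕ → ℕ
ind j i with j ≟ i
... | yes _ = 1
... | no  _ = 0

-- Γ(N)_i = Σ_{j ≡ i mod s} n_j   (all digits of N sit at positions j < N + 1)
Γ : (p s : ℕ) .{{_ : NonZero s}} → ℕ → Fin s → ℕ
Γ p s N i = sumTo (suc N) (λ j → ind (j % s) (toℕ i) * digit p j N)

InV : (p s m N : ℕ) → (Fin m → ℕ) → Set
InV p s m N X =
  (∀ k → 0 Data.Nat.< X k) ×
  (sumF X ≡ N) ×
  -- no carry-over: digits add componentwise
  (∀ j → sumF (λ k → digit p j (X k)) ≡ digit p j N) ×
  -- (p^s - 1) ∣ X_j for j ≤ m - 1  (0-indexed: toℕ k < m - 1)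
  (∀ k → toℕ k Data.Nat.< m ∸ 1 → (p ^ s ∸ 1) ∣ X k)

InVB : (p s m N : ℕ) .{{_ : NonZero s}} → (Fin s → Fin m → ℕ) → (Fin m → ℕ) → Set
InVB p s m N B X = InV p s m N X × (∀ i k → Γ p s (X k) i ≡ B i k)

-- τ-monotonic: for i < j and each residue h, every term p^a of τ_h(X_i) is
-- ≤ every term p^b of τ_h(X_j).  p^a is a term of τ_h(X_i) iff the a-th digit
-- of X_i is nonzero and a ≡ h (mod s).
τMonotonic : (p s m : ℕ) .{{_ : NonZero s}} → (Fin m → ℕ) → Set
τMonotonic p s m X =
  ∀ (i j : Fin m) → i Data.Fin.< j → ∀ (h : Fin s) (a b : ℕ) →
  digit p a (X i) ≢ 0 → a % s ≡ toℕ h →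
  digit p b (X j) ≢ 0 → b % s ≡ toℕ h →
  p ^ a Data.Nat.≤ p ^ b

-- Fix a residue class h mod s and lay the class-h digits of N end to end on a line, digit n_j
-- occupying a slot of length n_j; row h of B cuts the same line into consecutive blocks, one per
-- part.  Giving part k, at position j, the length of the overlap of block k with slot j yields a
-- composition without carries whose Γ is B, and it is τ-monotonic because slots and blocks are
-- both ordered along the line.  Conversely, in a τ-monotonic composition the class-h mass that
-- the first k parts carry below position j is the minimum of the length of the first k blocks
-- and that of the slots below j, which determines every digit of every part.  Positivity and
-- divisibility by p^s − 1 transfer from any member of V_m^B(N), because
-- n ≡ Σ_h p^h Γ(n)_h (mod p^s − 1).

module Submission where

open import Defs
open import Data.Empty using (⊥-elim)
open import Data.Fin using (Fin; toℕ; fromℕ<)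
import Data.Fin.Properties as Finₚ
open import Data.Nat
  using (ℕ; zero; suc; _+_; _*_; _∸_; _^_; _⊓_; _⊔_; _≤_; _<_; z≤n; s≤s; _≤′_; ≤′-refl; ≤′-step;
         _≟_; _<?_; _≤?_; NonZero; >-nonZero; >-nonZero⁻¹)
open import Data.Nat.DivMod
open import Data.Nat.Divisibility using (_∣_; divides-refl; m%n≡0⇒n∣m; n∣m⇒m%n≡0)
open import Data.Nat.Primality using (Prime; prime)
open import Data.Nat.Properties
open import Data.Product using (Σ; ∃; _×_; _,_; proj₁; proj₂)
open import Data.Sum using (inj₁; inj₂)
open import Function using (_∘_)
open import Relation.Binary.PropositionalEquality
  using (_≡_; _≢_; refl; sym; trans; cong; cong₂; subst; subst₂; module ≡-Reasoning)
open import Relation.Nullary using (Dec; yes; no)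
open import Algebra.Properties.CommutativeSemigroup +-commutativeSemigroup using (interchange)

sumTo-cong : ∀ n {f g : ℕ → ℕ} → (∀ i → i < n → f i ≡ g i) → sumTo n f ≡ sumTo n g
sumTo-cong zero    f≡g = refl
sumTo-cong (suc n) f≡g = cong₂ _+_ (sumTo-cong n (λ i i<n → f≡g i (m<n⇒m<1+n i<n))) (f≡g n ≤-refl)

sumTo-zero : ∀ n {f : ℕ → ℕ} → (∀ i → i < n → f i ≡ 0) → sumTo n f ≡ 0
sumTo-zero zero    f≡0 = refl
sumTo-zero (suc n) f≡0 = cong₂ _+_ (sumTo-zero n (λ i i<n → f≡0 i (m<n⇒m<1+n i<n))) (f≡0 n ≤-refl)

sumTo-suc : ∀ n (f : ℕ → ℕ) → sumTo (suc n) f ≡ f 0 + sumTo n (f ∘ suc)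
sumTo-suc zero    f = sym (+-identityʳ (f 0))
sumTo-suc (suc n) f = trans (cong (_+ f (suc n)) (sumTo-suc n f)) (+-assoc (f 0) _ _)

sumTo-+ : ∀ n (f g : ℕ → ℕ) → sumTo n (λ i → f i + g i) ≡ sumTo n f + sumTo n g
sumTo-+ zero    f g = refl
sumTo-+ (suc n) f g = trans (cong (_+ (f n + g n)) (sumTo-+ n f g)) (interchange (sumTo n f) (sumTo n g) (f n) (g n))

sumTo-*ˡ : ∀ n c (f : ℕ → ℕ) → sumTo n (λ i → c * f i) ≡ c * sumTo n f
sumTo-*ˡ zero    c f = sym (*-zeroʳ c)
sumTo-*ˡ (suc n) c f = trans (cong (_+ c * f n) (sumTo-*ˡ n c f)) (sym (*-distribˡ-+ c _ _))

sumTo-monoʳ-≤ : ∀ n {f g : ℕ → ℕ} → (∀ i → i < n → f i ≤ g i) → sumTo n f ≤ sumTo n g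
sumTo-monoʳ-≤ zero    f≤g = z≤n
sumTo-monoʳ-≤ (suc n) f≤g = +-mono-≤ (sumTo-monoʳ-≤ n (λ i i<n → f≤g i (m<n⇒m<1+n i<n))) (f≤g n ≤-refl)

sumTo-monoˡ-≤ : ∀ (f : ℕ → ℕ) {n n′} → n ≤ n′ → sumTo n f ≤ sumTo n′ f
sumTo-monoˡ-≤ f {n} n≤n′ = go (≤⇒≤′ n≤n′)
  where
  go : ∀ {n′} → n ≤′ n′ → sumTo n f ≤ sumTo n′ f
  go ≤′-refl          = ≤-refl
  go (≤′-step n≤′n′) = ≤-trans (go n≤′n′) (m≤m+n _ _)

sumTo-vanishing : ∀ (f : ℕ → ℕ) {n n′} → n ≤ n′ → (∀ i → n ≤ i → i < n′ → f i ≡ 0) →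
  sumTo n′ f ≡ sumTo n f
sumTo-vanishing f {n} n≤n′ f≡0 = go (≤⇒≤′ n≤n′) f≡0
  where
  go : ∀ {n′} → n ≤′ n′ → (∀ i → n ≤ i → i < n′ → f i ≡ 0) → sumTo n′ f ≡ sumTo n f
  go ≤′-refl                    _   = refl
  go (≤′-step {n = n′} n≤′n′) f≡0 =
    trans (cong₂ _+_ (go n≤′n′ (λ i n≤i i<n′ → f≡0 i n≤i (m<n⇒m<1+n i<n′)))
                     (f≡0 n′ (≤′⇒≤ n≤′n′) ≤-refl))
          (+-identityʳ _)

sumTo-<⇒∃≢0 : ∀ (f : ℕ → ℕ) {n n′} → n ≤ n′ → sumTo n f < sumTo n′ f →
  ∃ λ i → n ≤ i × i < n′ × f i ≢ 0
sumTo-<⇒∃≢0 f {n} n≤n′ = go (≤⇒≤′ n≤n′)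
  where
  go : ∀ {n′} → n ≤′ n′ → sumTo n f < sumTo n′ f → ∃ λ i → n ≤ i × i < n′ × f i ≢ 0
  go ≤′-refl sum<sum = ⊥-elim (<-irrefl refl sum<sum)
  go (≤′-step {n = n′} n≤′n′) sum<sum with f n′ ≟ 0
  ... | no  fn′≢0 = n′ , ≤′⇒≤ n≤′n′ , ≤-refl , fn′≢0
  ... | yes fn′≡0 =
    let sum≡sum = trans (cong (sumTo n′ f +_) fn′≡0) (+-identityʳ _)
        i , n≤i , i<n′ , fi≢0 = go n≤′n′ (subst (sumTo n f <_) sum≡sum sum<sum)
    in  i , n≤i , m<n⇒m<1+n i<n′ , fi≢0

sumTo≢0⇒∃≢0 : ∀ n (f : ℕ → ℕ) → sumTo n f ≢ 0 → ∃ λ i → i < n × f i ≢ 0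
sumTo≢0⇒∃≢0 n f sum≢0 = let i , _ , i<n , fi≢0 = sumTo-<⇒∃≢0 f z≤n (n≢0⇒n>0 sum≢0) in i , i<n , fi≢0

ind-refl : ∀ r → ind r r ≡ 1
ind-refl r with r ≟ r
... | yes _   = refl
... | no  r≢r = ⊥-elim (r≢r refl)

ind-≢ : ∀ {r h} → r ≢ h → ind r h ≡ 0
ind-≢ {r} {h} r≢h with r ≟ h
... | yes r≡h = ⊥-elim (r≢h r≡h)
... | no  _   = refl

ind*≢0⇒ : ∀ r h x → ind r h * x ≢ 0 → r ≡ h × x ≢ 0
ind*≢0⇒ r h x ind*x≢0 with r ≟ h
... | yes r≡h = r≡h , λ x≡0 → ind*x≢0 (trans (+-identityʳ x) x≡0)
... | no  _   = ⊥-elim (ind*x≢0 refl)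

sumTo-ind : ∀ n r (f : ℕ → ℕ) → r < n → sumTo n (λ h → f h * ind r h) ≡ f r
sumTo-ind (suc n) r f r<1+n with m≤n⇒m<n∨m≡n (≤-pred r<1+n)
... | inj₁ r<n  = trans (cong₂ _+_ (sumTo-ind n r f r<n) (trans (cong (f n *_) (ind-≢ (<⇒≢ r<n))) (*-zeroʳ (f n))))
                        (+-identityʳ (f r))
... | inj₂ refl = cong₂ _+_ (sumTo-zero r (λ h h<r → trans (cong (f h *_) (ind-≢ (>⇒≢ h<r))) (*-zeroʳ (f h))))
                            (trans (cong (f r *_) (ind-refl r)) (*-identityʳ (f r)))

sumF-cong : ∀ {m} {f g : Fin m → ℕ} → (∀ k → f k ≡ g k) → sumF f ≡ sumF g
sumF-cong {zero}  f≡g = refl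
sumF-cong {suc m} f≡g = cong₂ _+_ (f≡g Fin.zero) (sumF-cong (f≡g ∘ Fin.suc))

sumF-toℕ : ∀ m (f : ℕ → ℕ) → sumF {m} (f ∘ toℕ) ≡ sumTo m f
sumF-toℕ zero    f = refl
sumF-toℕ (suc m) f = trans (cong (f 0 +_) (sumF-toℕ m (f ∘ suc))) (sym (sumTo-suc m f))

sumF-*ˡ : ∀ {m} c (f : Fin m → ℕ) → sumF (λ k → c * f k) ≡ c * sumF f
sumF-*ˡ {zero}  c f = sym (*-zeroʳ c)
sumF-*ˡ {suc m} c f = trans (cong (c * f Fin.zero +_) (sumF-*ˡ c (f ∘ Fin.suc))) (sym (*-distribˡ-+ c _ _))

sumF-sumTo-comm : ∀ {m} n (f : Fin m → ℕ → ℕ) → sumF (λ k → sumTo n (f k)) ≡ sumTo n (λ j → sumF (λ k → f k j))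
sumF-sumTo-comm {zero}  n f = sym (sumTo-zero n (λ _ _ → refl))
sumF-sumTo-comm {suc m} n f =
  trans (cong (sumTo n (f Fin.zero) +_) (sumF-sumTo-comm n (f ∘ Fin.suc))) (sym (sumTo-+ n (f Fin.zero) _))

term≤sumF : ∀ {m} (f : Fin m → ℕ) k → f k ≤ sumF f
term≤sumF f Fin.zero    = m≤m+n _ _
term≤sumF f (Fin.suc k) = ≤-trans (term≤sumF (f ∘ Fin.suc) k) (m≤n+m _ _)

extendByZero : ∀ {m} → (Fin m → ℕ) → ℕ → ℕ
extendByZero {m} f k with k <? m
... | yes k<m = f (fromℕ< k<m)
... | no  _   = 0

extendByZero-fromℕ< : ∀ {m} (f : Fin m → ℕ) {k} (k<m : k < m) → extendByZero f k ≡ f (fromℕ< k<m)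
extendByZero-fromℕ< {m} f {k} k<m with k <? m
... | yes _   = refl
... | no  k≮m = ⊥-elim (k≮m k<m)

extendByZero-toℕ : ∀ {m} (f : Fin m → ℕ) k → extendByZero f (toℕ k) ≡ f k
extendByZero-toℕ f k = trans (extendByZero-fromℕ< f (Finₚ.toℕ<n k)) (cong f (Finₚ.fromℕ<-toℕ k _))

extendByZero-≤ : ∀ {m} {f : Fin m → ℕ} {c} → (∀ k → f k ≤ c) → ∀ k → extendByZero f k ≤ c
extendByZero-≤ {m} f≤c k with k <? m
... | yes k<m = f≤c (fromℕ< k<m)
... | no  _   = z≤n

sumF≡sumTo-extendByZero : ∀ {m} (f : Fin m → ℕ) → sumF f ≡ sumTo m (extendByZero f)
sumF≡sumTo-extendByZero {m} f = trans (sumF-cong (sym ∘ extendByZero-toℕ f)) (sumF-toℕ m (extendByZero f))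

-- Overlaps of intervals

overlapLength : ℕ → ℕ → ℕ → ℕ → ℕ
overlapLength a b x y = (b ⊓ y) ∸ (a ⊔ x)

clamp : ℕ → ℕ → ℕ → ℕ
clamp a b t = (t ⊔ a) ⊓ b

overlapLength-comm : ∀ a b x y → overlapLength a b x y ≡ overlapLength x y a b
overlapLength-comm a b x y = cong₂ _∸_ (⊓-comm b y) (⊔-comm a x)

overlapLength≤ : ∀ a b x y → overlapLength a b x y ≤ b ∸ a
overlapLength≤ a b x y = ∸-mono (m⊓n≤m b y) (m≤m⊔n a x)

overlapLength≢0⇒ : ∀ a b x y → overlapLength a b x y ≢ 0 → a < y × x < b
overlapLength≢0⇒ a b x y overlapLength≢0 =
    ≤-<-trans (m≤m⊔n a x) (<-≤-trans a⊔x<b⊓y (m⊓n≤n b y))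
  , ≤-<-trans (m≤n⊔m a x) (<-≤-trans a⊔x<b⊓y (m⊓n≤m b y))
  where a⊔x<b⊓y = m∸n≢0⇒n<m overlapLength≢0

overlapLength-⊆ : ∀ {a b x y} → x ≤ a → b ≤ y → overlapLength a b x y ≡ b ∸ a
overlapLength-⊆ x≤a b≤y = cong₂ _∸_ (m≤n⇒m⊓n≡m b≤y) (m≥n⇒m⊔n≡m x≤a)

clamp-mono : ∀ a b {t u} → t ≤ u → clamp a b t ≤ clamp a b u
clamp-mono a b t≤u = ⊓-monoˡ-≤ b (⊔-monoˡ-≤ a t≤u)

clamp-below : ∀ {a b t} → t ≤ a → a ≤ b → clamp a b t ≡ a
clamp-below {a} {b} t≤a a≤b = trans (cong (_⊓ b) (m≤n⇒m⊔n≡n t≤a)) (m≤n⇒m⊓n≡m a≤b)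

clamp-above : ∀ {a b t} → b ≤ t → clamp a b t ≡ b
clamp-above {a} {b} {t} b≤t = m≥n⇒m⊓n≡n (≤-trans b≤t (m≤m⊔n t a))

overlapLength≡clamp∸clamp : ∀ {a b x y} → a ≤ b → x ≤ y → overlapLength a b x y ≡ clamp a b y ∸ clamp a b x
overlapLength≡clamp∸clamp {a} {b} {x} {y} a≤b x≤y with ≤-total y a | ≤-total b x
... | inj₁ y≤a | _ =
  trans (m≤n⇒m∸n≡0 (≤-trans (m⊓n≤n b y) (≤-trans y≤a (m≤m⊔n a x))))
        (sym (trans (cong₂ _∸_ (clamp-below y≤a a≤b) (clamp-below (≤-trans x≤y y≤a) a≤b)) (n∸n≡0 a)))
... | inj₂ _ | inj₁ b≤x =
  trans (m≤n⇒m∸n≡0 (≤-trans (m⊓n≤m b y) (≤-trans b≤x (m≤n⊔m a x))))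
        (sym (trans (cong₂ _∸_ (clamp-above (≤-trans b≤x x≤y)) (clamp-above b≤x)) (n∸n≡0 b)))
... | inj₂ a≤y | inj₂ x≤b =
  sym (cong₂ _∸_ (trans (cong (_⊓ b) (m≥n⇒m⊔n≡m a≤y)) (⊓-comm y b))
                 (trans (m≤n⇒m⊓n≡m (⊔-lub x≤b a≤b)) (⊔-comm x a)))

[n∸m]+[o∸n]≡o∸m : ∀ {m n o} → m ≤ n → n ≤ o → (n ∸ m) + (o ∸ n) ≡ o ∸ m
[n∸m]+[o∸n]≡o∸m {m} {n} {o} m≤n n≤o =
  trans (+-comm (n ∸ m) (o ∸ n)) (trans (sym (+-∸-assoc (o ∸ n) m≤n)) (cong (_∸ m) (m∸n+n≡m n≤o)))

∸-telescope : ∀ n (f : ℕ → ℕ) → (∀ {i j} → i ≤ j → f i ≤ f j) →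
  sumTo n (λ i → f (suc i) ∸ f i) ≡ f n ∸ f 0
∸-telescope zero    f f-mono = sym (n∸n≡0 (f 0))
∸-telescope (suc n) f f-mono =
  trans (cong (_+ (f (suc n) ∸ f n)) (∸-telescope n f f-mono)) ([n∸m]+[o∸n]≡o∸m (f-mono z≤n) (f-mono (n≤1+n n)))

sumTo-overlapLength : ∀ n (g : ℕ → ℕ) {a b} → a ≤ b →
  sumTo n (λ i → overlapLength a b (sumTo i g) (sumTo (suc i) g)) ≡ overlapLength a b 0 (sumTo n g)
sumTo-overlapLength n g {a} {b} a≤b = begin
  sumTo n (λ i → overlapLength a b (sumTo i g) (sumTo (suc i) g))
    ≡⟨ sumTo-cong n (λ i _ → overlapLength≡clamp∸clamp a≤b (m≤m+n _ _)) ⟩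
  sumTo n (λ i → clamp a b (sumTo (suc i) g) ∸ clamp a b (sumTo i g))
    ≡⟨ ∸-telescope n (λ i → clamp a b (sumTo i g)) (clamp-mono a b ∘ sumTo-monoˡ-≤ g) ⟩
  clamp a b (sumTo n g) ∸ clamp a b 0
    ≡⟨ sym (overlapLength≡clamp∸clamp a≤b z≤n) ⟩
  overlapLength a b 0 (sumTo n g) ∎
  where open ≡-Reasoning

+-cong-% : ∀ d .{{_ : NonZero d}} {x x′ y y′} → x % d ≡ x′ % d → y % d ≡ y′ % d → (x + y) % d ≡ (x′ + y′) % d
+-cong-% d {x} {x′} {y} {y′} x≡x′ y≡y′ =
  trans (%-distribˡ-+ x y d) (trans (cong₂ (λ a b → (a + b) % d) x≡x′ y≡y′) (sym (%-distribˡ-+ x′ y′ d)))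

*-cong-% : ∀ d .{{_ : NonZero d}} {x x′ y y′} → x % d ≡ x′ % d → y % d ≡ y′ % d → (x * y) % d ≡ (x′ * y′) % d
*-cong-% d {x} {x′} {y} {y′} x≡x′ y≡y′ =
  trans (%-distribˡ-* x y d) (trans (cong₂ (λ a b → (a * b) % d) x≡x′ y≡y′) (sym (%-distribˡ-* x′ y′ d)))

sumTo-cong-% : ∀ d .{{_ : NonZero d}} n {f g : ℕ → ℕ} → (∀ i → f i % d ≡ g i % d) → sumTo n f % d ≡ sumTo n g % d
sumTo-cong-% d zero    f≡g = refl
sumTo-cong-% d (suc n) f≡g = +-cong-% d (sumTo-cong-% d n f≡g) (f≡g n)

-- Base-p digits

-- p is written 2 + q so that `digit p`, defined by matching on p, unfolds.
module Digits (q : ℕ) where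

  p : ℕ
  p = 2 + q

  1<p : 1 < p
  1<p = s≤s (s≤s z≤n)

  n<p^n : ∀ n → n < p ^ n
  n<p^n zero    = s≤s z≤n
  n<p^n (suc n) = ≤-<-trans (n<p^n n) (^-monoʳ-< p 1<p (n<1+n n))

  n<p^[1+n] : ∀ n → n < p ^ suc n
  n<p^[1+n] n = <-trans (n<1+n n) (n<p^n (suc n))

  digit-zeroʳ : ∀ j → digit p j 0 ≡ 0
  digit-zeroʳ j = cong (_% p) (0/n≡0 (p ^ j) {{m^n≢0 p j}})

  digit-zeroˡ : ∀ n → digit p 0 n ≡ n % p
  digit-zeroˡ n = cong (_% p) (n/1≡n n)

  digit-sucˡ : ∀ j n → digit p (suc j) n ≡ digit p j (n / p)
  digit-sucˡ j n = cong (_% p) (sym (m/n/o≡m/[n*o] n p (p ^ j) {{_}} {{m^n≢0 p j}} {{m^n≢0 p (suc j)}}))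

  digit<p : ∀ j n → digit p j n < p
  digit<p j n = m%n<n ((n / p ^ j) {{m^n≢0 p j}}) p

  digit≡0-beyond : ∀ {n j i} → n < p ^ j → j ≤ i → digit p i n ≡ 0
  digit≡0-beyond {i = i} n<p^j j≤i = cong (_% p) (m<n⇒m/n≡0 {{m^n≢0 p i}} (<-≤-trans n<p^j (^-monoʳ-≤ p j≤i)))

  fromDigits : ℕ → (ℕ → ℕ) → ℕ
  fromDigits L d = sumTo L (λ j → p ^ j * d j)

  fromDigits-cong : ∀ L {d e : ℕ → ℕ} → (∀ j → d j ≡ e j) → fromDigits L d ≡ fromDigits L e
  fromDigits-cong L d≡e = sumTo-cong L (λ j _ → cong (p ^ j *_) (d≡e j))

  fromDigits-suc : ∀ L d → fromDigits (suc L) d ≡ d 0 + fromDigits L (d ∘ suc) * p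
  fromDigits-suc L d = begin
    fromDigits (suc L) d
      ≡⟨ sumTo-suc L (λ j → p ^ j * d j) ⟩
    1 * d 0 + sumTo L (λ j → p * p ^ j * d (suc j))
      ≡⟨ cong₂ _+_ (*-identityˡ (d 0)) (sumTo-cong L (λ j _ → *-assoc p (p ^ j) (d (suc j)))) ⟩
    d 0 + sumTo L (λ j → p * (p ^ j * d (suc j)))
      ≡⟨ cong (d 0 +_) (trans (sumTo-*ˡ L p (λ j → p ^ j * d (suc j))) (*-comm p (fromDigits L (d ∘ suc)))) ⟩
    d 0 + fromDigits L (d ∘ suc) * p ∎
    where open ≡-Reasoning

  fromDigits-digits : ∀ L n → n < p ^ L → fromDigits L (λ j → digit p j n) ≡ n
  fromDigits-digits zero    zero    _           = refl
  fromDigits-digits zero    (suc n) (s≤s ())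
  fromDigits-digits (suc L) n       n<p^[1+L] = begin
    fromDigits (suc L) (λ j → digit p j n)
      ≡⟨ fromDigits-suc L _ ⟩
    digit p 0 n + fromDigits L (λ j → digit p (suc j) n) * p
      ≡⟨ cong₂ (λ a b → a + b * p) (digit-zeroˡ n) (fromDigits-cong L (λ j → digit-sucˡ j n)) ⟩
    n % p + fromDigits L (λ j → digit p j (n / p)) * p
      ≡⟨ cong (λ x → n % p + x * p) (fromDigits-digits L (n / p) n/p<p^L) ⟩
    n % p + n / p * p
      ≡⟨ sym (m≡m%n+[m/n]*n n p) ⟩
    n ∎
    where
    open ≡-Reasoning
    n/p<p^L : n / p < p ^ L
    n/p<p^L = m<n*o⇒m/o<n (subst (n <_) (*-comm p (p ^ L)) n<p^[1+L])

  [a+x*p]/p≡x : ∀ {a} x → a < p → (a + x * p) / p ≡ x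
  [a+x*p]/p≡x {a} x a<p = trans (+-distrib-/-∣ʳ a (divides-refl x)) (cong₂ _+_ (m<n⇒m/n≡0 a<p) (m*n/n≡m x p))

  digit-fromDigits : ∀ L (d : ℕ → ℕ) → (∀ i → d i < p) → (∀ i → L ≤ i → d i ≡ 0) →
    ∀ j → digit p j (fromDigits L d) ≡ d j
  digit-fromDigits zero    d d<p d≡0 j       = trans (digit-zeroʳ j) (sym (d≡0 j z≤n))
  digit-fromDigits (suc L) d d<p d≡0 zero    = begin
    digit p 0 (fromDigits (suc L) d)         ≡⟨ digit-zeroˡ (fromDigits (suc L) d) ⟩
    fromDigits (suc L) d % p                 ≡⟨ cong (_% p) (fromDigits-suc L d) ⟩
    (d 0 + fromDigits L (d ∘ suc) * p) % p   ≡⟨ [m+kn]%n≡m%n (d 0) (fromDigits L (d ∘ suc)) p ⟩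
    d 0 % p                                  ≡⟨ m<n⇒m%n≡m (d<p 0) ⟩
    d 0                                      ∎
    where open ≡-Reasoning
  digit-fromDigits (suc L) d d<p d≡0 (suc j) = begin
    digit p (suc j) (fromDigits (suc L) d)               ≡⟨ digit-sucˡ j (fromDigits (suc L) d) ⟩
    digit p j (fromDigits (suc L) d / p)                 ≡⟨ cong (λ x → digit p j (x / p)) (fromDigits-suc L d) ⟩
    digit p j ((d 0 + fromDigits L (d ∘ suc) * p) / p)   ≡⟨ cong (digit p j) ([a+x*p]/p≡x (fromDigits L (d ∘ suc)) (d<p 0)) ⟩
    digit p j (fromDigits L (d ∘ suc))                   ≡⟨ digit-fromDigits L (d ∘ suc) (d<p ∘ suc) d∘suc≡0 j ⟩
    d (suc j)                                            ∎
    where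
    open ≡-Reasoning
    d∘suc≡0 : ∀ i → L ≤ i → d (suc i) ≡ 0
    d∘suc≡0 i L≤i = d≡0 (suc i) (s≤s L≤i)

  digits≡0⇒≡0 : ∀ {n} → (∀ j → digit p j n ≡ 0) → n ≡ 0
  digits≡0⇒≡0 {n} digit≡0 = begin
    n                                  ≡⟨ sym (fromDigits-digits n n (n<p^n n)) ⟩
    fromDigits n (λ j → digit p j n)   ≡⟨ sumTo-zero n (λ j _ → trans (cong (p ^ j *_) (digit≡0 j)) (*-zeroʳ (p ^ j))) ⟩
    0                                  ∎
    where open ≡-Reasoning

  sumF-fromDigits : ∀ {m} L (d : Fin m → ℕ → ℕ) →
    sumF (λ k → fromDigits L (d k)) ≡ fromDigits L (λ j → sumF (λ k → d k j))
  sumF-fromDigits L d =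
    trans (sumF-sumTo-comm L (λ k j → p ^ j * d k j)) (sumTo-cong L (λ j _ → sumF-*ˡ (p ^ j) (λ k → d k j)))

-- Digit classes modulo s

module DigitClasses (q s : ℕ) .{{_ : NonZero s}} where
  open Digits q

  class : ℕ → Fin s
  class j = fromℕ< (m%n<n j s)

  toℕ-class : ∀ j → toℕ (class j) ≡ j % s
  toℕ-class j = Finₚ.toℕ-fromℕ< (m%n<n j s)

  class-≡ : ∀ {j h} → j % s ≡ toℕ h → class j ≡ h
  class-≡ {j} j∈h = Finₚ.toℕ-injective (trans (toℕ-class j) j∈h)

  ind-class : ∀ j → ind (j % s) (toℕ (class j)) ≡ 1
  ind-class j = trans (cong (ind (j % s)) (toℕ-class j)) (ind-refl (j % s))

  Γ-upTo : ℕ → ℕ → Fin s → ℕ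
  Γ-upTo j n h = sumTo j (λ i → ind (i % s) (toℕ h) * digit p i n)

  Γ-upTo-suc-class : ∀ j n → Γ-upTo (suc j) n (class j) ≡ Γ-upTo j n (class j) + digit p j n
  Γ-upTo-suc-class j n =
    cong (Γ-upTo j n (class j) +_) (trans (cong (_* digit p j n) (ind-class j)) (*-identityˡ (digit p j n)))

  Γ-upTo-suc-other : ∀ {j h} n → j % s ≢ toℕ h → Γ-upTo (suc j) n h ≡ Γ-upTo j n h
  Γ-upTo-suc-other {j} {h} n j∉h = trans (cong (λ c → Γ-upTo j n h + c * digit p j n) (ind-≢ j∉h)) (+-identityʳ _)

  Γ-upTo-vanishing : ∀ {j j′ n} h → n < p ^ j → j ≤ j′ → Γ-upTo j′ n h ≡ Γ-upTo j n h
  Γ-upTo-vanishing h n<p^j j≤j′ =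
    sumTo-vanishing _ j≤j′ (λ i j≤i _ →
      trans (cong (ind (i % s) (toℕ h) *_) (digit≡0-beyond n<p^j j≤i)) (*-zeroʳ (ind (i % s) (toℕ h))))

  Γ≡Γ-upTo : ∀ j {n} h → n < p ^ j → Γ p s n h ≡ Γ-upTo j n h
  Γ≡Γ-upTo j {n} h n<p^j with ≤-total (suc n) j
  ... | inj₁ 1+n≤j = sym (Γ-upTo-vanishing h (n<p^[1+n] n) 1+n≤j)
  ... | inj₂ j≤1+n = Γ-upTo-vanishing h n<p^j j≤1+n

  Γ-zero : ∀ h → Γ p s 0 h ≡ 0
  Γ-zero h = *-zeroʳ (ind (0 % s) (toℕ h))

  digit≤Γ : ∀ j n → digit p j n ≤ Γ p s n (class j)
  digit≤Γ j n = begin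
    digit p j n                          ≤⟨ m≤n+m _ _ ⟩
    Γ-upTo j n (class j) + digit p j n   ≡⟨ Γ-upTo-suc-class j n ⟨
    Γ-upTo (suc j) n (class j)           ≤⟨ sumTo-monoˡ-≤ _ (s≤s (m≤m+n j n)) ⟩
    Γ-upTo (suc (j + n)) n (class j)     ≡⟨ Γ≡Γ-upTo (suc (j + n)) (class j) n<p^[1+j+n] ⟨
    Γ p s n (class j)                    ∎
    where
    open ≤-Reasoning
    n<p^[1+j+n] : n < p ^ suc (j + n)
    n<p^[1+j+n] = <-≤-trans (n<p^[1+n] n) (^-monoʳ-≤ p (s≤s (m≤n+m n j)))

  Γ≡0⇒≡0 : ∀ {n} → (∀ h → Γ p s n h ≡ 0) → n ≡ 0
  Γ≡0⇒≡0 {n} Γ≡0 = digits≡0⇒≡0 (λ j → n≤0⇒n≡0 (subst (digit p j n ≤_) (Γ≡0 (class j)) (digit≤Γ j n)))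

  sumF-Γ-upTo : ∀ {m} j (Z : Fin m → ℕ) {n} → (∀ i → sumF (λ k → digit p i (Z k)) ≡ digit p i n) →
    ∀ h → sumF (λ k → Γ-upTo j (Z k) h) ≡ Γ-upTo j n h
  sumF-Γ-upTo j Z noCarry h = trans (sumF-sumTo-comm j (λ k i → ind (i % s) (toℕ h) * digit p i (Z k)))
    (sumTo-cong j (λ i _ →
      trans (sumF-*ˡ (ind (i % s) (toℕ h)) (λ k → digit p i (Z k))) (cong (ind (i % s) (toℕ h) *_) (noCarry i))))

  M : ℕ
  M = p ^ s ∸ 1

  instance
    M-nonZero : NonZero M
    M-nonZero = >-nonZero (≤-trans (s≤s z≤n) (∸-monoˡ-≤ 1 (^-monoʳ-≤ p (>-nonZero⁻¹ s))))

  p^s%M≡1%M : p ^ s % M ≡ 1 % M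
  p^s%M≡1%M = trans (cong (_% M) (sym (m+[n∸m]≡n (m^n>0 p s)))) ([m+n]%n≡m%n 1 M)

  p^j%M≡p^[j%s]%M : ∀ j → p ^ j % M ≡ p ^ (j % s) % M
  p^j%M≡p^[j%s]%M j = begin
    p ^ j % M
      ≡⟨ cong (λ e → p ^ e % M) (m≡m%n+[m/n]*n j s) ⟩
    p ^ (j % s + j / s * s) % M
      ≡⟨ cong (_% M) (^-distribˡ-+-* p (j % s) (j / s * s)) ⟩
    p ^ (j % s) * p ^ (j / s * s) % M
      ≡⟨ cong (λ e → p ^ (j % s) * e % M) (trans (cong (p ^_) (*-comm (j / s) s)) (sym (^-*-assoc p s (j / s)))) ⟩
    p ^ (j % s) * (p ^ s) ^ (j / s) % M
      ≡⟨ *-cong-% M {p ^ (j % s)} refl ([p^s]^t%M≡1%M (j / s)) ⟩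
    p ^ (j % s) * 1 % M
      ≡⟨ cong (_% M) (*-identityʳ _) ⟩
    p ^ (j % s) % M ∎
    where
    open ≡-Reasoning
    [p^s]^t%M≡1%M : ∀ t → (p ^ s) ^ t % M ≡ 1 % M
    [p^s]^t%M≡1%M zero    = refl
    [p^s]^t%M≡1%M (suc t) = *-cong-% M p^s%M≡1%M ([p^s]^t%M≡1%M t)

  Γ-weight : ℕ → ℕ
  Γ-weight n = sumF {s} (λ h → p ^ toℕ h * Γ p s n h)

  Γ-weight≡sumTo : ∀ n → Γ-weight n ≡ sumTo (suc n) (λ j → p ^ (j % s) * digit p j n)
  Γ-weight≡sumTo n = begin
    sumF {s} (λ h → p ^ toℕ h * sumTo (suc n) (λ j → ind (j % s) (toℕ h) * digit p j n))
      ≡⟨ sumF-cong {s} (λ h → sym (sumTo-*ˡ (suc n) (p ^ toℕ h) (λ j → ind (j % s) (toℕ h) * digit p j n))) ⟩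
    sumF {s} (λ h → sumTo (suc n) (λ j → p ^ toℕ h * (ind (j % s) (toℕ h) * digit p j n)))
      ≡⟨ sumF-sumTo-comm {s} (suc n) (λ h j → p ^ toℕ h * (ind (j % s) (toℕ h) * digit p j n)) ⟩
    sumTo (suc n) (λ j → sumF {s} (λ h → p ^ toℕ h * (ind (j % s) (toℕ h) * digit p j n)))
      ≡⟨ sumTo-cong (suc n) (λ j _ → classSum j) ⟩
    sumTo (suc n) (λ j → p ^ (j % s) * digit p j n) ∎
    where
    open ≡-Reasoning
    classSum : ∀ j → sumF {s} (λ h → p ^ toℕ h * (ind (j % s) (toℕ h) * digit p j n)) ≡ p ^ (j % s) * digit p j n
    classSum j = begin
      sumF {s} (λ h → p ^ toℕ h * (ind (j % s) (toℕ h) * digit p j n))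
        ≡⟨ sumF-toℕ s (λ h → p ^ h * (ind (j % s) h * digit p j n)) ⟩
      sumTo s (λ h → p ^ h * (ind (j % s) h * digit p j n))
        ≡⟨ sumTo-cong s (λ h _ → x*[y*z]≡x*z*y (p ^ h) (ind (j % s) h) (digit p j n)) ⟩
      sumTo s (λ h → p ^ h * digit p j n * ind (j % s) h)
        ≡⟨ sumTo-ind s (j % s) (λ h → p ^ h * digit p j n) (m%n<n j s) ⟩
      p ^ (j % s) * digit p j n ∎
      where
      x*[y*z]≡x*z*y : ∀ x y z → x * (y * z) ≡ x * z * y
      x*[y*z]≡x*z*y x y z = trans (cong (x *_) (*-comm y z)) (sym (*-assoc x z y))

  n%M≡Γ-weight%M : ∀ n → n % M ≡ Γ-weight n % M
  n%M≡Γ-weight%M n = begin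
    n % M                                                ≡⟨ cong (_% M) (fromDigits-digits (suc n) n (n<p^[1+n] n)) ⟨
    sumTo (suc n) (λ j → p ^ j * digit p j n) % M        ≡⟨ sumTo-cong-% M (suc n) (λ j → *-cong-% M (p^j%M≡p^[j%s]%M j) refl) ⟩
    sumTo (suc n) (λ j → p ^ (j % s) * digit p j n) % M  ≡⟨ cong (_% M) (Γ-weight≡sumTo n) ⟨
    Γ-weight n % M                                       ∎
    where open ≡-Reasoning

  M∣-resp-Γ : ∀ {x y} → (∀ h → Γ p s x h ≡ Γ p s y h) → M ∣ y → M ∣ x
  M∣-resp-Γ {x} {y} Γx≡Γy M∣y = m%n≡0⇒n∣m x M (begin
    x % M           ≡⟨ n%M≡Γ-weight%M x ⟩
    Γ-weight x % M  ≡⟨ cong (_% M) (sumF-cong (λ h → cong (p ^ toℕ h *_) (Γx≡Γy h))) ⟩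
    Γ-weight y % M  ≡⟨ n%M≡Γ-weight%M y ⟨
    y % M           ≡⟨ n∣m⇒m%n≡0 y M M∣y ⟩
    0               ∎)
    where open ≡-Reasoning

-- Compositions with prescribed Γ

module Compositions (q s m N : ℕ) .{{_ : NonZero s}} (B : Fin s → Fin m → ℕ) where
  open Digits q
  open DigitClasses q s

  L : ℕ
  L = suc N

  N<p^L : N < p ^ L
  N<p^L = n<p^[1+n] N

  -- Within class h, the class-h digits of N fill [0, T h L) consecutively, digit j occupying
  -- the slot [T h j, T h (suc j)); row h of B cuts the same line into the blocks [S h k, S h (suc k)).
  T : Fin s → ℕ → ℕ
  T h j = Γ-upTo j N h

  S : Fin s → ℕ → ℕ
  S h k = sumTo k (extendByZero (B h))

  T-step : ∀ h j → T h j ≤ T h (suc j)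
  T-step h j = m≤m+n (T h j) (ind (j % s) (toℕ h) * digit p j N)

  S-step : ∀ h k → S h k ≤ S h (suc k)
  S-step h k = m≤m+n (S h k) (extendByZero (B h) k)

  T≤T-L : ∀ h j → T h j ≤ T h L
  T≤T-L h j with ≤-total j L
  ... | inj₁ j≤L = sumTo-monoˡ-≤ _ j≤L
  ... | inj₂ L≤j = ≤-reflexive (Γ-upTo-vanishing h N<p^L L≤j)

  module Member {Z : Fin m → ℕ} (Z∈ : InVB p s m N B Z) where

    Z-positive : ∀ k → 0 < Z k
    Z-positive = proj₁ (proj₁ Z∈)

    Z-noCarry : ∀ j → sumF (λ k → digit p j (Z k)) ≡ digit p j N
    Z-noCarry = proj₁ (proj₂ (proj₂ (proj₁ Z∈)))

    M∣Z : ∀ k → toℕ k < m ∸ 1 → M ∣ Z k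
    M∣Z = proj₂ (proj₂ (proj₂ (proj₁ Z∈)))

    ΓZ≡B : ∀ h k → Γ p s (Z k) h ≡ B h k
    ΓZ≡B = proj₂ Z∈

    Z≤N : ∀ k → Z k ≤ N
    Z≤N k = subst (Z k ≤_) (proj₁ (proj₂ (proj₁ Z∈))) (term≤sumF Z k)

    S-total : ∀ h → S h m ≡ T h L
    S-total h = begin
      sumTo m (extendByZero (B h))   ≡⟨ sumF≡sumTo-extendByZero (B h) ⟨
      sumF (B h)                     ≡⟨ sumF-cong (λ k → trans (sym (ΓZ≡B h k)) (Γ≡Γ-upTo L h (≤-<-trans (Z≤N k) N<p^L))) ⟩
      sumF (λ k → Γ-upTo L (Z k) h)  ≡⟨ sumF-Γ-upTo L Z Z-noCarry h ⟩
      T h L                          ∎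
      where open ≡-Reasoning

    S≤T-L : ∀ h {k} → k ≤ m → S h k ≤ T h L
    S≤T-L h k≤m = ≤-trans (sumTo-monoˡ-≤ _ k≤m) (≤-reflexive (S-total h))

  cell : Fin s → ℕ → ℕ → ℕ
  cell h k j = overlapLength (T h j) (T h (suc j)) (S h k) (S h (suc k))

  greedyDigit : ℕ → ℕ → ℕ
  greedyDigit k j = cell (class j) k j

  greedyDigit≤digit : ∀ k j → greedyDigit k j ≤ digit p j N
  greedyDigit≤digit k j = subst (greedyDigit k j ≤_)
    (trans (cong (_∸ T (class j) j) (Γ-upTo-suc-class j N)) (m+n∸m≡n (T (class j) j) (digit p j N)))
    (overlapLength≤ (T (class j) j) (T (class j) (suc j)) (S (class j) k) (S (class j) (suc k)))

  greedyDigit<p : ∀ k j → greedyDigit k j < p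
  greedyDigit<p k j = ≤-<-trans (greedyDigit≤digit k j) (digit<p j N)

  greedyDigit-vanishing : ∀ k j → L ≤ j → greedyDigit k j ≡ 0
  greedyDigit-vanishing k j L≤j = n≤0⇒n≡0 (subst (greedyDigit k j ≤_) (digit≡0-beyond N<p^L L≤j) (greedyDigit≤digit k j))

  ind*greedyDigit : ∀ h k j → ind (j % s) (toℕ h) * greedyDigit k j ≡ cell h k j
  ind*greedyDigit h k j = byClass (j % s ≟ toℕ h)
    where
    open ≡-Reasoning
    byClass : Dec (j % s ≡ toℕ h) → ind (j % s) (toℕ h) * greedyDigit k j ≡ cell h k j
    byClass (yes j∈h) = begin
      ind (j % s) (toℕ h) * greedyDigit k j
        ≡⟨ cong (_* greedyDigit k j) (trans (cong (λ r → ind r (toℕ h)) j∈h) (ind-refl (toℕ h))) ⟩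
      1 * greedyDigit k j
        ≡⟨ *-identityˡ _ ⟩
      cell (class j) k j
        ≡⟨ cong (λ h′ → cell h′ k j) (class-≡ j∈h) ⟩
      cell h k j ∎
    byClass (no j∉h) = begin
      ind (j % s) (toℕ h) * greedyDigit k j
        ≡⟨ cong (_* greedyDigit k j) (ind-≢ j∉h) ⟩
      0
        ≡⟨ n≤0⇒n≡0 (≤-trans (overlapLength≤ (T h j) (T h j) _ _) (≤-reflexive (n∸n≡0 (T h j)))) ⟨
      overlapLength (T h j) (T h j) (S h k) (S h (suc k))
        ≡⟨ cong (λ t → overlapLength (T h j) t (S h k) (S h (suc k))) (Γ-upTo-suc-other N j∉h) ⟨
      cell h k j ∎

  module Greedy {Y : Fin m → ℕ} (Y∈ : InVB p s m N B Y) where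
    open Member Y∈

    sumTo-greedyDigit : ∀ j → sumTo m (λ k → greedyDigit k j) ≡ digit p j N
    sumTo-greedyDigit j = begin
      sumTo m (λ k → cell h k j)
        ≡⟨ sumTo-overlapLength m (extendByZero (B h)) (T-step h j) ⟩
      overlapLength (T h j) (T h (suc j)) 0 (S h m)
        ≡⟨ overlapLength-⊆ {T h j} z≤n (subst (T h (suc j) ≤_) (sym (S-total h)) (T≤T-L h (suc j))) ⟩
      T h (suc j) ∸ T h j
        ≡⟨ cong (_∸ T h j) (Γ-upTo-suc-class j N) ⟩
      T h j + digit p j N ∸ T h j
        ≡⟨ m+n∸m≡n (T h j) (digit p j N) ⟩
      digit p j N ∎
      where
      open ≡-Reasoning
      h = class j

    sumTo-cell : ∀ h {k} → k < m → sumTo L (λ j → cell h k j) ≡ extendByZero (B h) k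
    sumTo-cell h {k} k<m = begin
      sumTo L (λ j → cell h k j)
        ≡⟨ sumTo-cong L (λ j _ → overlapLength-comm (T h j) (T h (suc j)) (S h k) (S h (suc k))) ⟩
      sumTo L (λ j → overlapLength (S h k) (S h (suc k)) (T h j) (T h (suc j)))
        ≡⟨ sumTo-overlapLength L (λ i → ind (i % s) (toℕ h) * digit p i N) (S-step h k) ⟩
      overlapLength (S h k) (S h (suc k)) 0 (T h L)
        ≡⟨ overlapLength-⊆ {S h k} z≤n (S≤T-L h k<m) ⟩
      S h k + extendByZero (B h) k ∸ S h k
        ≡⟨ m+n∸m≡n (S h k) (extendByZero (B h) k) ⟩
      extendByZero (B h) k ∎
      where open ≡-Reasoning

    greedy : Fin m → ℕ
    greedy k = fromDigits L (greedyDigit (toℕ k))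

    digit-greedy : ∀ k j → digit p j (greedy k) ≡ greedyDigit (toℕ k) j
    digit-greedy k = digit-fromDigits L _ (greedyDigit<p (toℕ k)) (greedyDigit-vanishing (toℕ k))

    greedy-noCarry : ∀ j → sumF (λ k → digit p j (greedy k)) ≡ digit p j N
    greedy-noCarry j =
      trans (sumF-cong {m} (λ k → digit-greedy k j)) (trans (sumF-toℕ m (λ k → greedyDigit k j)) (sumTo-greedyDigit j))

    greedy-sum : sumF greedy ≡ N
    greedy-sum = begin
      sumF greedy
        ≡⟨ sumF-fromDigits {m} L (greedyDigit ∘ toℕ) ⟩
      fromDigits L (λ j → sumF {m} (λ k → greedyDigit (toℕ k) j))
        ≡⟨ fromDigits-cong L (λ j → trans (sumF-toℕ m (λ k → greedyDigit k j)) (sumTo-greedyDigit j)) ⟩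
      fromDigits L (λ j → digit p j N)
        ≡⟨ fromDigits-digits L N N<p^L ⟩
      N ∎
      where open ≡-Reasoning

    Γ-greedy : ∀ h k → Γ p s (greedy k) h ≡ B h k
    Γ-greedy h k = begin
      Γ p s (greedy k) h
        ≡⟨ Γ≡Γ-upTo L h (≤-<-trans greedy≤N N<p^L) ⟩
      Γ-upTo L (greedy k) h
        ≡⟨ sumTo-cong L (λ j _ → trans (cong (ind (j % s) (toℕ h) *_) (digit-greedy k j)) (ind*greedyDigit h (toℕ k) j)) ⟩
      sumTo L (λ j → cell h (toℕ k) j)
        ≡⟨ sumTo-cell h (Finₚ.toℕ<n k) ⟩
      extendByZero (B h) (toℕ k)
        ≡⟨ extendByZero-toℕ (B h) k ⟩
      B h k ∎
      where
      open ≡-Reasoning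
      greedy≤N : greedy k ≤ N
      greedy≤N = subst (greedy k ≤_) greedy-sum (term≤sumF greedy k)

    greedy-positive : ∀ k → 0 < greedy k
    greedy-positive k = n≢0⇒n>0 λ greedy≡0 → <⇒≢ (Z-positive k) (sym (Γ≡0⇒≡0 λ h → begin
      Γ p s (Y k) h       ≡⟨ ΓZ≡B h k ⟩
      B h k               ≡⟨ Γ-greedy h k ⟨
      Γ p s (greedy k) h  ≡⟨ cong (λ n → Γ p s n h) greedy≡0 ⟩
      Γ p s 0 h           ≡⟨ Γ-zero h ⟩
      0                   ∎))
      where open ≡-Reasoning

    greedy-divisible : ∀ k → toℕ k < m ∸ 1 → M ∣ greedy k
    greedy-divisible k k<m-1 = M∣-resp-Γ (λ h → trans (Γ-greedy h k) (sym (ΓZ≡B h k))) (M∣Z k k<m-1)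

    greedy∈VB : InVB p s m N B greedy
    greedy∈VB = (greedy-positive , greedy-sum , greedy-noCarry , greedy-divisible) , Γ-greedy

    greedy-digit≢0⇒ : ∀ {k a h} → digit p a (greedy k) ≢ 0 → a % s ≡ toℕ h →
      T h a < S h (suc (toℕ k)) × S h (toℕ k) < T h (suc a)
    greedy-digit≢0⇒ {k} {a} digit≢0 a∈h = overlapLength≢0⇒ _ _ _ _ λ cell≡0 →
      digit≢0 (trans (digit-greedy k a) (trans (cong (λ h′ → cell h′ (toℕ k) a) (class-≡ a∈h)) cell≡0))

    greedy-τMonotonic : τMonotonic p s m greedy
    greedy-τMonotonic i j i<j h a b digitᵢ≢0 a∈h digitⱼ≢0 b∈h with a ≤? b
    ... | yes a≤b = ^-monoʳ-≤ p a≤b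
    ... | no  a≰b = ⊥-elim (<-irrefl refl (begin-strict
      S h (toℕ j)        <⟨ proj₂ (greedy-digit≢0⇒ digitⱼ≢0 b∈h) ⟩
      T h (suc b)        ≤⟨ sumTo-monoˡ-≤ _ (≰⇒> a≰b) ⟩
      T h a              <⟨ proj₁ (greedy-digit≢0⇒ digitᵢ≢0 a∈h) ⟩
      S h (suc (toℕ i))  ≤⟨ sumTo-monoˡ-≤ _ i<j ⟩
      S h (toℕ j)        ∎))
      where open ≤-Reasoning

  fill : Fin s → ℕ → ℕ → ℕ
  fill h k j = (S h (suc k) ⊓ T h j) ∸ (S h k ⊓ T h j)

  forcedDigit : ℕ → ℕ → ℕ
  forcedDigit k j = fill (class j) k (suc j) ∸ fill (class j) k j

  module Monotone {Z : Fin m → ℕ} (Z∈ : InVB p s m N B Z) (Z-mono : τMonotonic p s m Z) where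
    open Member Z∈

    Zℕ : ℕ → ℕ
    Zℕ = extendByZero Z

    G : Fin s → ℕ → ℕ → ℕ
    G h k j = Γ-upTo j (Zℕ k) h

    F : Fin s → ℕ → ℕ → ℕ
    F h k j = sumTo k (λ k′ → G h k′ j)

    Zℕ<p^L : ∀ k → Zℕ k < p ^ L
    Zℕ<p^L k = ≤-<-trans (extendByZero-≤ Z≤N k) N<p^L

    G-total : ∀ h {k} → k < m → G h k L ≡ extendByZero (B h) k
    G-total h {k} k<m = begin
      Γ-upTo L (Zℕ k) h       ≡⟨ cong (λ n → Γ-upTo L n h) (extendByZero-fromℕ< Z k<m) ⟩
      Γ-upTo L (Z k′) h       ≡⟨ Γ≡Γ-upTo L h (≤-<-trans (Z≤N k′) N<p^L) ⟨
      Γ p s (Z k′) h          ≡⟨ ΓZ≡B h k′ ⟩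
      B h k′                  ≡⟨ extendByZero-fromℕ< (B h) k<m ⟨
      extendByZero (B h) k    ∎
      where
      open ≡-Reasoning
      k′ = fromℕ< k<m

    G[j+L]≡B : ∀ h {k} j → k < m → G h k (j + L) ≡ extendByZero (B h) k
    G[j+L]≡B h {k} j k<m = trans (Γ-upTo-vanishing h (Zℕ<p^L k) (m≤n+m L j)) (G-total h k<m)

    G≤B : ∀ h {k} j → k < m → G h k j ≤ extendByZero (B h) k
    G≤B h j k<m = ≤-trans (sumTo-monoˡ-≤ _ (m≤m+n j L)) (≤-reflexive (G[j+L]≡B h j k<m))

    F-all : ∀ h j → F h m j ≡ T h j
    F-all h j = begin
      sumTo m (λ k → Γ-upTo j (Zℕ k) h)
        ≡⟨ sumF-toℕ m (λ k → Γ-upTo j (Zℕ k) h) ⟨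
      sumF {m} (λ k → Γ-upTo j (Zℕ (toℕ k)) h)
        ≡⟨ sumF-cong {m} (λ k → cong (λ n → Γ-upTo j n h) (extendByZero-toℕ Z k)) ⟩
      sumF (λ k → Γ-upTo j (Z k) h)
        ≡⟨ sumF-Γ-upTo j Z Z-noCarry h ⟩
      T h j ∎
      where open ≡-Reasoning

    F≤S : ∀ h {k} j → k ≤ m → F h k j ≤ S h k
    F≤S h {k} j k≤m = sumTo-monoʳ-≤ k (λ k′ k′<k → G≤B h j (<-≤-trans k′<k k≤m))

    F≤T : ∀ h {k} j → k ≤ m → F h k j ≤ T h j
    F≤T h j k≤m = ≤-trans (sumTo-monoˡ-≤ _ k≤m) (≤-reflexive (F-all h j))

    Zℕ-τMonotonic : ∀ h {k k′} a b → k < k′ → k′ < m →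
      digit p a (Zℕ k) ≢ 0 → a % s ≡ toℕ h → digit p b (Zℕ k′) ≢ 0 → b % s ≡ toℕ h → p ^ a ≤ p ^ b
    Zℕ-τMonotonic h {k} {k′} a b k<k′ k′<m Zₖ[a]≢0 a∈h Zₖ′[b]≢0 b∈h =
      Z-mono (fromℕ< k<m) (fromℕ< k′<m)
        (subst₂ _<_ (sym (Finₚ.toℕ-fromℕ< k<m)) (sym (Finₚ.toℕ-fromℕ< k′<m)) k<k′) h a b
        (Zₖ[a]≢0 ∘ trans (cong (digit p a) (extendByZero-fromℕ< Z k<m))) a∈h
        (Zₖ′[b]≢0 ∘ trans (cong (digit p b) (extendByZero-fromℕ< Z k′<m))) b∈h
      where
      k<m : k < m
      k<m = <-trans k<k′ k′<m

    -- A part that still lacks class-h mass below j carries a class-h digit at some position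
    -- a ≥ j, so by τ-monotonicity no later part has a class-h digit at a position b < j.
    later-parts-empty : ∀ h {k k′} j → k < k′ → k′ < m → G h k j < extendByZero (B h) k → G h k′ j ≡ 0
    later-parts-empty h {k} {k′} j k<k′ k′<m G<B with G h k′ j ≟ 0
    ... | yes G≡0 = G≡0
    ... | no  G≢0 =
      let b , b<j , b-term≢0     = sumTo≢0⇒∃≢0 j _ G≢0
          a , j≤a , _ , a-term≢0 = sumTo-<⇒∃≢0 _ (m≤m+n j L) G[j]<G[j+L]
          a∈h , Zₖ[a]≢0          = ind*≢0⇒ (a % s) (toℕ h) _ a-term≢0
          b∈h , Zₖ′[b]≢0         = ind*≢0⇒ (b % s) (toℕ h) _ b-term≢0
      in  ⊥-elim (<⇒≱ (^-monoʳ-< p 1<p (<-≤-trans b<j j≤a))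
                      (Zℕ-τMonotonic h a b k<k′ k′<m Zₖ[a]≢0 a∈h Zₖ′[b]≢0 b∈h))
      where
      G[j]<G[j+L] : G h k j < G h k (j + L)
      G[j]<G[j+L] = subst (G h k j <_) (sym (G[j+L]≡B h j (<-trans k<k′ k′<m))) G<B

    S⊓T≤F : ∀ h k j → k ≤ m → S h k ⊓ T h j ≤ F h k j
    S⊓T≤F h zero    j _   = z≤n
    S⊓T≤F h (suc k) j k<m with G h k j <? extendByZero (B h) k
    ... | yes G<B = begin
      S h (suc k) ⊓ T h j  ≤⟨ m⊓n≤n _ _ ⟩
      T h j                ≡⟨ F-all h j ⟨
      F h m j              ≡⟨ sumTo-vanishing _ k<m (λ k′ k<k′ k′<m → later-parts-empty h j k<k′ k′<m G<B) ⟩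
      F h (suc k) j        ∎
      where open ≤-Reasoning
    ... | no  G≮B = begin
      S h (suc k) ⊓ T h j              ≤⟨ ⊓-monoʳ-≤ (S h (suc k)) (m≤m+n (T h j) b) ⟩
      (S h k + b) ⊓ (T h j + b)        ≡⟨ +-distribʳ-⊓ b (S h k) (T h j) ⟨
      S h k ⊓ T h j + b                ≤⟨ +-monoˡ-≤ b (S⊓T≤F h k j (<⇒≤ k<m)) ⟩
      F h k j + b                      ≡⟨ cong (F h k j +_) (≤-antisym (G≤B h j k<m) (≮⇒≥ G≮B)) ⟨
      F h (suc k) j                    ∎
      where
      open ≤-Reasoning
      b = extendByZero (B h) k

    F≡S⊓T : ∀ h k j → k ≤ m → F h k j ≡ S h k ⊓ T h j
    F≡S⊓T h k j k≤m = ≤-antisym (⊓-glb (F≤S h j k≤m) (F≤T h j k≤m)) (S⊓T≤F h k j k≤m)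

    G≡fill : ∀ h {k} j → k < m → G h k j ≡ fill h k j
    G≡fill h {k} j k<m = begin
      G h k j                          ≡⟨ m+n∸m≡n (F h k j) (G h k j) ⟨
      F h (suc k) j ∸ F h k j          ≡⟨ cong₂ _∸_ (F≡S⊓T h (suc k) j k<m) (F≡S⊓T h k j (<⇒≤ k<m)) ⟩
      fill h k j                       ∎
      where open ≡-Reasoning

    digit≡forcedDigit : ∀ {k} j → k < m → digit p j (Zℕ k) ≡ forcedDigit k j
    digit≡forcedDigit {k} j k<m = begin
      digit p j (Zℕ k)                                  ≡⟨ m+n∸m≡n (G h k j) (digit p j (Zℕ k)) ⟨
      G h k j + digit p j (Zℕ k) ∸ G h k j              ≡⟨ cong (_∸ G h k j) (Γ-upTo-suc-class j (Zℕ k)) ⟨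
      G h k (suc j) ∸ G h k j                           ≡⟨ cong₂ _∸_ (G≡fill h (suc j) k<m) (G≡fill h j k<m) ⟩
      forcedDigit k j                                   ∎
      where
      open ≡-Reasoning
      h = class j

    Z≡fromDigits-forcedDigit : ∀ k → Z k ≡ fromDigits L (forcedDigit (toℕ k))
    Z≡fromDigits-forcedDigit k = begin
      Z k                                        ≡⟨ fromDigits-digits L (Z k) (≤-<-trans (Z≤N k) N<p^L) ⟨
      fromDigits L (λ j → digit p j (Z k))       ≡⟨ fromDigits-cong L (λ j → cong (digit p j) (extendByZero-toℕ Z k)) ⟨
      fromDigits L (λ j → digit p j (Zℕ (toℕ k))) ≡⟨ fromDigits-cong L (λ j → digit≡forcedDigit j (Finₚ.toℕ<n k)) ⟩
      fromDigits L (forcedDigit (toℕ k))         ∎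
      where open ≡-Reasoning

  τMonotonic-unique : ∀ {Z Z′} → InVB p s m N B Z → InVB p s m N B Z′ →
    τMonotonic p s m Z → τMonotonic p s m Z′ → ∀ k → Z k ≡ Z′ k
  τMonotonic-unique Z∈ Z′∈ Z-mono Z′-mono k =
    trans (Monotone.Z≡fromDigits-forcedDigit Z∈ Z-mono k) (sym (Monotone.Z≡fromDigits-forcedDigit Z′∈ Z′-mono k))

lemma3p2 : (p s m N : ℕ) .{{_ : NonZero s}} → Prime p → 1 ≤ m → 0 < N →
    (B : Fin s → Fin m → ℕ) →
    ∃ (λ Y → InVB p s m N B Y) →
    Σ (Fin m → ℕ) (λ X → (InVB p s m N B X × τMonotonic p s m X) ×
      (∀ Y → InVB p s m N B Y → τMonotonic p s m Y → ∀ k → Y k ≡ X k))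
lemma3p2 0 _ _ _ (prime {{()}} _)
lemma3p2 1 _ _ _ (prime {{()}} _)
lemma3p2 (suc (suc q)) s m N _ _ _ B (Y , Y∈) =
  greedy , (greedy∈VB , greedy-τMonotonic) , λ Z Z∈ Z-mono → τMonotonic-unique Z∈ greedy∈VB Z-mono greedy-τMonotonic
  where
  open Compositions q s m N B
  open Greedy Y∈
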